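{- Let $k\ge0$ be an integer and let $\mathcal{C}$ be a hereditary class of digraphs. If there exists an integer $c$ such that every $D\in\mathcal{C}$ has a $k$-nice set $S$ with $\vec{\chi}(S)\le c$, then $\vec{\chi}(D)\le 2c(k+1)$ for every $D\in\mathcal{C}$.
   Context: All digraphs are finite, loopless, with at most one arc between any two vertices. A class $\mathcal{C}$ of digraphs is hereditary if every induced subdigraph of a member of $\mathcal{C}$ is in $\mathcal{C}$. $\vec{\chi}(D)$ is the dichromatic number (least $k$ such that $V(D)$ partitions into $k$ sets inducing acyclic subdigraphs), and $\vec{\chi}(S)=\vec{\chi}(D[S])$. A set $S\subseteq V(D)$ with $S\neq\emptyset$ is $k$-nice if there is a partition $S_1,S_2$ of $S$ such that every vertex in $S_1$ has at most $k$ in-neighbours in $V(D)\setminus S$ and every vertex in $S_2$ has at most $k$ out-neighbours in $V(D)\setminus S$. -}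

module Defs where

open import Data.Nat using (ℕ; zero; suc; _≤_; _+_; _*_)
open import Data.Fin using (Fin; zero; suc; inject₁; fromℕ; _≟_)
open import Data.Bool using (Bool; true; false; T; _∧_; not)
open import Data.List using (List; length; allFin; filterᵇ)
open import Data.Product using (Σ; ∃; _×_; _,_)
open import Relation.Binary.PropositionalEquality using (_≡_)
open import Relation.Nullary using (¬_)
open import Relation.Nullary.Decidable using (⌊_⌋)
open import Function.Definitions using (Injective)

record Digraph (n : ℕ) : Set where
  field
    arc       : Fin n → Fin n → Bool
    loopless  : ∀ v → arc v v ≡ false
    oneArc    : ∀ u v → T (arc u v) → arc v u ≡ false
open Digraph public

induced : ∀ {m n} → Digraph n → (f : Fin m → Fin n) → Injective _≡_ _≡_ f → Digraph m
induced D f inj = record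
  { arc      = λ i j → arc D (f i) (f j)
  ; loopless = λ i → loopless D (f i)
  ; oneArc   = λ i j → oneArc D (f i) (f j)
  }

Class : Set₁
Class = ∀ {n} → Digraph n → Set

Hereditary : Class → Set
Hereditary 𝒞 = ∀ {m n} (D : Digraph n) (f : Fin m → Fin n)
  (inj : Injective _≡_ _≡_ f) → 𝒞 D → 𝒞 (induced D f inj)

VSet : ℕ → Set
VSet n = Fin n → Bool

record DirCycle {n} (D : Digraph n) (S : VSet n) : Set where
  field
    len     : ℕ
    vert    : Fin (suc len) → Fin n
    inj     : Injective _≡_ _≡_ vert
    inS     : ∀ i → T (S (vert i))
    step    : ∀ (i : Fin len) → T (arc D (vert (inject₁ i)) (vert (suc i)))
    closing : T (arc D (vert (fromℕ len)) (vert zero))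

Acyclic : ∀ {n} → Digraph n → VSet n → Set
Acyclic D S = ¬ DirCycle D S

colourClass : ∀ {n c} → VSet n → (Fin n → Fin c) → Fin c → VSet n
colourClass S col a v = S v ∧ ⌊ col v ≟ a ⌋

DichromaticLE : ∀ {n} → Digraph n → VSet n → ℕ → Set
DichromaticLE {n} D S c =
  Σ (Fin n → Fin c) λ col → ∀ (a : Fin c) → Acyclic D (colourClass S col a)

full : ∀ {n} → VSet n
full _ = true

DichromaticLE-D : ∀ {n} → Digraph n → ℕ → Set
DichromaticLE-D D c = DichromaticLE D full c

inOutside : ∀ {n} → Digraph n → VSet n → Fin n → ℕ
inOutside {n} D S v = length (filterᵇ (λ u → arc D u v ∧ not (S u)) (allFin n))

outOutside : ∀ {n} → Digraph n → VSet n → Fin n → ℕ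
outOutside {n} D S v = length (filterᵇ (λ u → arc D v u ∧ not (S u)) (allFin n))

-- S is k-nice: S ≠ ∅ and there is a partition S₁ , S₂ of S (side v = true
-- means v ∈ S₁, false means v ∈ S₂) such that every vertex of S₁ has at
-- most k in-neighbours outside S and every vertex of S₂ has at most k
-- out-neighbours outside S.
Nice : ∀ {n} → ℕ → Digraph n → VSet n → Set
Nice {n} k D S =
  (∃ λ v → T (S v)) ×
  Σ (Fin n → Bool) λ side →
    ∀ v → T (S v) →
      (T (side v) → inOutside D S v ≤ k) ×
      (T (not (side v)) → outOutside D S v ≤ k)

-- Take a k-nice set S with χ⃗(S) ≤ c and a vertex v₀ ∈ S,
-- and dicolour D − v₀ by induction with colours (side, colour in S, label), of which there are
-- 2 · c · (k + 1). Every vertex of S keeps its side and its colour from the c-colouring of D[S],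
-- and takes a label that no in-neighbour (if it lies in S₁) resp. out-neighbour (if in S₂)
-- outside S uses; at most k labels are forbidden, so one of the k + 1 is free. A monochromatic
-- cycle cannot lie inside S (colour in S) nor outside S (induction), so it enters S through an
-- arc u → v with v ∈ S₁ or leaves S through an arc v → u with v ∈ S₂ (all its S-vertices have
-- the same side), and in either case u and v have different labels.
module Submission where

open import Defs
open import Data.Nat using (ℕ; suc; _*_; _+_)
open import Data.Product using (Σ; _×_)

open import Data.Nat using (zero; _≤_; _<_; s≤s; z≤n)
open import Data.Nat.Properties using (+-comm)
open import Data.Fin using (Fin; zero; suc; inject₁; fromℕ; combine; punchIn; punchOut; toℕ; _≟_)
open import Data.Fin.Properties
  using (pigeonhole; ≤fromℕ; punchIn-injective; punchIn-punchOut; combine-injective; 2↔Bool;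
         ¬Fin0; <-irrefl)
  renaming (any? to anyFin?)
open import Data.Bool using (Bool; true; false; T; not; _∧_; if_then_else_)
open import Data.Bool.Properties using (T-∧; T-≡; T-not-≡)
open import Data.Product using (_,_; proj₁; proj₂; ∃; ∃₂)
open import Data.List using (List; length; map; filterᵇ; allFin; lookup)
open import Data.List.Properties using (length-map)
open import Data.List.Relation.Unary.Any using (index; any?)
open import Data.List.Relation.Unary.Any.Properties using (lookup-index)
open import Data.List.Membership.Propositional using (_∈_; _∉_)
open import Data.List.Membership.Propositional.Properties using (∈-filter⁺; ∈-map⁺; ∈-allFin)
open import Data.Vec.Functional using (insertAt)
open import Data.Vec.Functional.Properties using (insertAt-punchIn)
open import Data.Empty using (⊥; ⊥-elim)
open import Data.Unit using (tt)
open import Function using (_∘_; Inverse)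
open import Function.Definitions using (Injective)
open import Function.Bundles using (Equivalence; Injection)
open import Function.Properties.Inverse using (↔⇒↣; ↔-sym)
open import Relation.Binary.PropositionalEquality
open import Relation.Nullary using (¬_; yes; no; ¬?)
open import Relation.Nullary.Decidable using (T?; toWitness; fromWitness; decidable-stable)
open import Relation.Unary using (Pred; Decidable; ∁)

open DirCycle
open Equivalence using (to; from)

¬T⇒T-not : ∀ {b} → ¬ T b → T (not b)
¬T⇒T-not {false} _  = tt
¬T⇒T-not {true}  ¬t = ¬t tt

T-not⇒¬T : ∀ {b} → T (not b) → ¬ T b
T-not⇒¬T {false} _ ()

short-list-misses : ∀ {N} (xs : List (Fin N)) → length xs < N → ¬ (∀ b → b ∈ xs)
short-list-misses xs short all∈ with pigeonhole short (index ∘ all∈)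
... | i , j , i<j , same-index = <-irrefl (begin
  i                          ≡⟨ lookup-index (all∈ i) ⟩
  lookup xs (index (all∈ i)) ≡⟨ cong (lookup xs) same-index ⟩
  lookup xs (index (all∈ j)) ≡⟨ lookup-index (all∈ j) ⟨
  j                          ∎) i<j
  where open ≡-Reasoning

avoid : ∀ {N} → List (Fin (suc N)) → Fin (suc N)
avoid xs with anyFin? (λ b → ¬? (any? (b ≟_) xs))
... | yes (b , _) = b
... | no _        = zero

avoid-∉ : ∀ {N} (xs : List (Fin (suc N))) → length xs < suc N → avoid xs ∉ xs
avoid-∉ xs short with anyFin? (λ b → ¬? (any? (b ≟_) xs))
... | yes (_ , b∉xs) = b∉xs
... | no  ¬∃∉        = ⊥-elim (short-list-misses xs short λ b →
                         decidable-stable (any? (b ≟_) xs) λ b∉xs → ¬∃∉ (b , b∉xs))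

descent : ∀ {l p} {P : Pred (Fin (suc l)) p} → Decidable P → {i j : Fin (suc l)} →
  toℕ i ≤ toℕ j → P i → ¬ P j → ∃ λ (d : Fin l) → P (inject₁ d) × ¬ P (suc d)
descent         _  {zero}  {zero}  _         pi ¬pj = ⊥-elim (¬pj pi)
descent {suc l} P? {zero}  {suc j} _         pi ¬pj with P? (suc zero)
... | no ¬p₁ = zero , pi , ¬p₁
... | yes p₁ with descent (P? ∘ suc) {zero} {j} z≤n p₁ ¬pj
...   | d , pd , ¬pd = suc d , pd , ¬pd
descent {suc l} P? {suc i} {suc j} (s≤s i≤j) pi ¬pj with descent (P? ∘ suc) i≤j pi ¬pj
... | d , pd , ¬pd = suc d , pd , ¬pd

Monochromatic : ∀ {n} {D : Digraph n} {S : VSet n} {A : Set} → (Fin n → A) → DirCycle D S → Set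
Monochromatic col C = ∀ i j → col (vert C i) ≡ col (vert C j)

IsDicolouring : ∀ {n} {A : Set} → Digraph n → VSet n → (Fin n → A) → Set
IsDicolouring D S col = ∀ (C : DirCycle D S) → ¬ Monochromatic col C

cycle-within : ∀ {n} {D : Digraph n} {S S′ : VSet n} (C : DirCycle D S) →
  (∀ i → T (S′ (vert C i))) → DirCycle D S′
cycle-within C inS′ = record
  { len = len C ; vert = vert C ; inj = inj C ; inS = inS′ ; step = step C ; closing = closing C }

module _ {n} {D : Digraph n} {S : VSet n} where

  ArcLeaving : ∀ {p} → Pred (Fin n) p → DirCycle D S → Set p
  ArcLeaving P C = ∃₂ λ a b → T (arc D (vert C a) (vert C b)) × P (vert C a) × ¬ P (vert C b)

  stepLeaving : ∀ {p} {P : Pred (Fin n) p} (C : DirCycle D S) →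
    (∃ λ d → P (vert C (inject₁ d)) × ¬ P (vert C (suc d))) → ArcLeaving P C
  stepLeaving C (d , pd , ¬pd) = inject₁ d , suc d , step C d , pd , ¬pd

  leavingArc : ∀ {p} {P : Pred (Fin n) p} → Decidable P → (C : DirCycle D S) {i j : Fin (suc (len C))} →
    P (vert C i) → ¬ P (vert C j) → ArcLeaving P C
  leavingArc {P = P} P? C {i} pi ¬pj with P? (vert C zero) | P? (vert C (fromℕ (len C)))
  ... | yes p₀ | _      = stepLeaving {P = P} C (descent (P? ∘ vert C) z≤n p₀ ¬pj)
  ... | no ¬p₀ | yes pₗ = fromℕ (len C) , zero , closing C , pₗ , ¬p₀
  ... | no ¬p₀ | no ¬pₗ = stepLeaving {P = P} C (descent (P? ∘ vert C) (≤fromℕ i) pi ¬pₗ)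

  enteringArc : ∀ {p} {P : Pred (Fin n) p} → Decidable P → (C : DirCycle D S) {i j : Fin (suc (len C))} →
    P (vert C i) → ¬ P (vert C j) → ArcLeaving (∁ P) C
  enteringArc P? C pi ¬pj = leavingArc (¬? ∘ P?) C ¬pj (λ ¬pi → ¬pi pi)

  dichromaticLE⇒isDicolouring : ∀ {c} ((col , _) : DichromaticLE D S c) → IsDicolouring D S col
  dichromaticLE⇒isDicolouring (col , acyclic) C mono =
    acyclic (col (vert C zero)) (cycle-within C λ i → from T-∧ (inS C i , fromWitness (mono i zero)))

  isDicolouring⇒dichromaticLE : ∀ {A : Set} {c} (col : Fin n → A) (encode : A → Fin c) →
    Injective _≡_ _≡_ encode → IsDicolouring D S col → DichromaticLE D S c
  isDicolouring⇒dichromaticLE col encode encode-injective dicolours = encode ∘ col , λ a C →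
    let inClass = λ i → to T-∧ (inS C i)
        hasColour = λ i → toWitness (proj₂ (inClass i))
    in dicolours (cycle-within C (proj₁ ∘ inClass))
                 (λ i j → encode-injective (trans (hasColour i) (sym (hasColour j))))

inducedCycle : ∀ {m n} {D : Digraph n} {S : VSet n} (f : Fin m → Fin n) (f-injective : Injective _≡_ _≡_ f)
  (C : DirCycle D S) (g : Fin (suc (len C)) → Fin m) → (∀ i → f (g i) ≡ vert C i) →
  DirCycle (induced D f f-injective) full
inducedCycle {D = D} f _ C g fg≗vert = record
  { len = len C ; vert = g
  ; inj = λ {i} {j} gi≡gj → inj C (trans (sym (fg≗vert i)) (trans (cong f gi≡gj) (fg≗vert j)))
  ; inS = λ _ → tt
  ; step = λ d → pull (step C d)
  ; closing = pull (closing C) }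
  where
  pull : ∀ {i j} → T (arc D (vert C i) (vert C j)) → T (arc D (f (g i)) (f (g j)))
  pull {i} {j} = subst₂ (λ u v → T (arc D u v)) (sym (fg≗vert i)) (sym (fg≗vert j))

punchIn-injective′ : ∀ {n} (v : Fin (suc n)) → Injective _≡_ _≡_ (punchIn v)
punchIn-injective′ v = punchIn-injective v _ _

insertAt-isDicolouring : ∀ {n} {A : Set} (D : Digraph (suc n)) (v₀ : Fin (suc n)) {R : VSet (suc n)} →
  ¬ T (R v₀) → (col : Fin n → A) →
  IsDicolouring (induced D (punchIn v₀) (punchIn-injective′ v₀)) full col →
  (d : A) → IsDicolouring D R (insertAt col v₀ d)
insertAt-isDicolouring D v₀ {R} v₀∉R col dicolours d C mono =
  dicolours (inducedCycle (punchIn v₀) (punchIn-injective′ v₀) C g (punchIn-punchOut ∘ v₀≢))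
            (λ i j → trans (lifted i) (trans (mono i j) (sym (lifted j))))
  where
  v₀≢ : ∀ i → v₀ ≢ vert C i
  v₀≢ i v₀≡ = v₀∉R (subst (T ∘ R) (sym v₀≡) (inS C i))
  g : Fin (suc (len C)) → Fin _
  g i = punchOut (v₀≢ i)
  lifted : ∀ i → col (g i) ≡ insertAt col v₀ d (vert C i)
  lifted i = trans (sym (insertAt-punchIn col v₀ d (g i)))
                   (cong (insertAt col v₀ d) (punchIn-punchOut (v₀≢ i)))

Colour : ℕ → ℕ → Set
Colour k c = Bool × Fin c × Fin (suc k)

label : ∀ {k c} → Colour k c → Fin (suc k)
label (_ , _ , b) = b

module NiceExtension {k c n} (D : Digraph n) (S : VSet n) (side : Fin n → Bool)
  (bounds : ∀ v → T (S v) →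
    (T (side v) → inOutside D S v ≤ k) × (T (not (side v)) → outOutside D S v ≤ k))
  (colS : Fin n → Fin c) (colS-dicolours : IsDicolouring D S colS)
  (out : Fin n → Colour k c) (out-dicolours : IsDicolouring D (not ∘ S) out) where

  inNeighboursOutside outNeighboursOutside : Fin n → List (Fin n)
  inNeighboursOutside  v = filterᵇ (λ u → arc D u v ∧ not (S u)) (allFin n)
  outNeighboursOutside v = filterᵇ (λ u → arc D v u ∧ not (S u)) (allFin n)

  forbiddenLabels : List (Fin n) → List (Fin (suc k))
  forbiddenLabels = map (label ∘ out)

  freshLabel : Fin n → Fin (suc k)
  freshLabel v = if side v then avoid (forbiddenLabels (inNeighboursOutside v))
                           else avoid (forbiddenLabels (outNeighboursOutside v))

  freshLabel-S₁ : ∀ {v} → T (side v) → freshLabel v ≡ avoid (forbiddenLabels (inNeighboursOutside v))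
  freshLabel-S₁ {v} v∈S₁ with side v
  ... | true = refl

  freshLabel-S₂ : ∀ {v} → T (not (side v)) → freshLabel v ≡ avoid (forbiddenLabels (outNeighboursOutside v))
  freshLabel-S₂ {v} v∈S₂ with side v
  ... | false = refl

  colour : Fin n → Colour k c
  colour v = if S v then (side v , colS v , freshLabel v) else out v

  colour-inside : ∀ {v} → T (S v) → colour v ≡ (side v , colS v , freshLabel v)
  colour-inside {v} v∈S with S v
  ... | true = refl

  colour-outside : ∀ {v} → ¬ T (S v) → colour v ≡ out v
  colour-outside {v} v∉S with S v
  ... | true  = ⊥-elim (v∉S tt)
  ... | false = refl

  forbidden⇒colour≢ : ∀ {u v} (us : List (Fin n)) → u ∈ us → length us ≤ k → ¬ T (S u) → T (S v) →
    freshLabel v ≡ avoid (forbiddenLabels us) → colour u ≢ colour v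
  forbidden⇒colour≢ {u} {v} us u∈us few u∉S v∈S fresh≡avoid same =
    avoid-∉ (forbiddenLabels us) short
      (subst (_∈ forbiddenLabels us) label≡avoid (∈-map⁺ (label ∘ out) u∈us))
    where
    short : length (forbiddenLabels us) < suc k
    short = subst (_< suc k) (sym (length-map (label ∘ out) us)) (s≤s few)
    label≡avoid : label (out u) ≡ avoid (forbiddenLabels us)
    label≡avoid = begin
      label (out u)                ≡⟨ cong label (colour-outside u∉S) ⟨
      label (colour u)             ≡⟨ cong label same ⟩
      label (colour v)             ≡⟨ cong label (colour-inside v∈S) ⟩
      freshLabel v                 ≡⟨ fresh≡avoid ⟩
      avoid (forbiddenLabels us)   ∎
      where open ≡-Reasoning

  arcInto-S₁ : ∀ {u v} → T (arc D u v) → ¬ T (S u) → T (S v) → T (side v) → colour u ≢ colour v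
  arcInto-S₁ {u} {v} uv u∉S v∈S v∈S₁ = forbidden⇒colour≢ (inNeighboursOutside v)
    (∈-filter⁺ (λ w → T? (arc D w v ∧ not (S w))) (∈-allFin u) (from T-∧ (uv , ¬T⇒T-not u∉S)))
    (proj₁ (bounds v v∈S) v∈S₁) u∉S v∈S (freshLabel-S₁ v∈S₁)

  arcOutOf-S₂ : ∀ {v u} → T (arc D v u) → T (S v) → ¬ T (S u) → T (not (side v)) → colour u ≢ colour v
  arcOutOf-S₂ {v} {u} vu v∈S u∉S v∈S₂ = forbidden⇒colour≢ (outNeighboursOutside v)
    (∈-filter⁺ (λ w → T? (arc D v w ∧ not (S w))) (∈-allFin u) (from T-∧ (vu , ¬T⇒T-not u∉S)))
    (proj₂ (bounds v v∈S) v∈S₂) u∉S v∈S (freshLabel-S₂ v∈S₂)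

  crossingCycle : (C : DirCycle D full) → Monochromatic colour C →
    ∀ {i j} → T (S (vert C i)) → ¬ T (S (vert C j)) → ⊥
  crossingCycle C mono i∈S j∉S
    with leavingArc (T? ∘ S) C i∈S j∉S | enteringArc (T? ∘ S) C i∈S j∉S
  ... | a , b , ab , a∈S , b∉S | a′ , b′ , a′b′ , a′∉S , ¬b′∉S with side (vert C a) in side-a
  ... | true  = arcInto-S₁ a′b′ a′∉S b′∈S (from T-≡ (trans same-side side-a)) (mono a′ b′)
    where
    b′∈S = decidable-stable (T? (S (vert C b′))) ¬b′∉S
    same-side : side (vert C b′) ≡ side (vert C a)
    same-side = cong proj₁ (trans (sym (colour-inside b′∈S)) (trans (mono b′ a) (colour-inside a∈S)))
  ... | false = arcOutOf-S₂ ab a∈S b∉S (from T-not-≡ side-a) (mono b a)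

  colour-dicolours : IsDicolouring D full colour
  colour-dicolours C mono
    with anyFin? (λ i → T? (S (vert C i))) | anyFin? (λ j → ¬? (T? (S (vert C j))))
  ... | yes (i , i∈S) | yes (j , j∉S) = crossingCycle C mono i∈S j∉S
  ... | _             | no ∄outside   = colS-dicolours (cycle-within C inside) λ i j →
          cong (proj₁ ∘ proj₂)
            (trans (sym (colour-inside (inside i))) (trans (mono i j) (colour-inside (inside j))))
    where
    inside : ∀ i → T (S (vert C i))
    inside i = decidable-stable (T? _) λ i∉S → ∄outside (i , i∉S)
  ... | no ∄inside    | yes _         = out-dicolours (cycle-within C (¬T⇒T-not ∘ outside)) λ i j →
          trans (sym (colour-outside (outside i))) (trans (mono i j) (colour-outside (outside j)))
    where
    outside : ∀ i → ¬ T (S (vert C i))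
    outside i i∈S = ∄inside (i , i∈S)

module _ {k} {𝒞 : Class} (hereditary : Hereditary 𝒞) {c}
  (niceSet : ∀ {n} (D : Digraph (suc n)) → 𝒞 D →
    Σ (VSet (suc n)) λ S → Nice k D S × DichromaticLE D S c)
  where

  dicolouring : ∀ {n} (D : Digraph n) → 𝒞 D → Σ (Fin n → Colour k c) (IsDicolouring D full)
  dicolouring {zero}  D _  = (λ ()) , λ C _ → ¬Fin0 (vert C zero)
  dicolouring {suc n} D D∈𝒞 with niceSet D D∈𝒞
  ... | S , ((v₀ , v₀∈S) , side , bounds) , dichromaticS@(colS , _) = colour , colour-dicolours
    where
    D−v₀ = induced D (punchIn v₀) (punchIn-injective′ v₀)
    rest = dicolouring D−v₀ (hereditary D (punchIn v₀) (punchIn-injective′ v₀) D∈𝒞)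
    -- the colour given to v₀ here is irrelevant: v₀ ∈ S is recoloured
    out = insertAt (proj₁ rest) v₀ (side v₀ , colS v₀ , zero)
    open NiceExtension D S side bounds colS (dichromaticLE⇒isDicolouring dichromaticS)
      out (insertAt-isDicolouring D v₀ (λ v₀∉S → T-not⇒¬T v₀∉S v₀∈S) (proj₁ rest) (proj₂ rest) _)

encode : ∀ {k c} → Colour k c → Fin (2 * c * suc k)
encode (s , a , b) = combine (combine (Inverse.from 2↔Bool s) a) b

encode-injective : ∀ {k c} → Injective _≡_ _≡_ (encode {k} {c})
encode-injective {x = s , a , b} {s′ , a′ , b′} same
  with combine-injective (combine (Inverse.from 2↔Bool s) a) b (combine (Inverse.from 2↔Bool s′) a′) b′ same
... | sa≡s′a′ , refl
  with combine-injective (Inverse.from 2↔Bool s) a (Inverse.from 2↔Bool s′) a′ sa≡s′a′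
... | from-s≡from-s′ , refl =
  cong (_, a , b) (Injection.injective (↔⇒↣ (↔-sym 2↔Bool)) from-s≡from-s′)

lemma5p1 : (k : ℕ) (𝒞 : Class) → Hereditary 𝒞 →
    (c : ℕ) →
    (∀ {n} (D : Digraph (suc n)) → 𝒞 D →
      Σ (VSet (suc n)) λ S → Nice k D S × DichromaticLE D S c) →
    ∀ {n} (D : Digraph n) → 𝒞 D → DichromaticLE-D D (2 * c * (k + 1))
lemma5p1 k 𝒞 hereditary c niceSet D D∈𝒞 rewrite +-comm k 1 =
  isDicolouring⇒dichromaticLE (proj₁ colouring) encode encode-injective (proj₂ colouring)
  where
  colouring = dicolouring hereditary niceSet D D∈𝒞
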